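{- Let $G$ and $G'$ be two graphs on the same finite set $V$ of $v$ vertices and let $k$ be an integer with $4\leq k\leq v$. Consider the statements: (i) for every $k$-element subset $K$ of $V$, $e(G'_{\restriction K})\in\{e(G_{\restriction K}),e(\overline G_{\restriction K})\}$ and $h^{(3)}(G_{\restriction K})=h^{(3)}(G'_{\restriction K})$; (ii) there is an integer $k'$ with $3\leq k'<k$ such that for every subset $K$ of $V$ with $|K|\in\{k,k'\}$, $e(G'_{\restriction K})\in\{e(G_{\restriction K}),e(\overline G_{\restriction K})\}$; (iii) for every integer $l$ with $k\leq l\leq v$ and every $l$-element subset $L$ of $V$, $e(G'_{\restriction L})\in\{e(G_{\restriction L}),e(\overline G_{\restriction L})\}$ and $h^{(3)}(G_{\restriction L})=h^{(3)}(G'_{\restriction L})$. Then (ii) implies (i), and (i) implies (iii).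
   Context: A graph is a pair $G=(V,E)$ with $E$ a set of 2-element subsets of $V$; $\overline G$ is its complement, $G_{\restriction K}$ the induced subgraph on $K$, and $e(H)$ the number of edges of $H$. A $3$-homogeneous subset of $G$ is a 3-element subset of $V$ all of whose pairs are edges of $G$, or all of whose pairs are non-edges; $h^{(3)}(G)$ is the number of $3$-homogeneous subsets of $G$. -}

module Defs where

open import Data.Nat using (ℕ; _<_)
open import Data.Bool using (Bool; true; false; _∧_; _∨_; not; if_then_else_) renaming (_≟_ to _≟ᵇ_)
open import Data.Empty using (⊥-elim)
open import Data.Sum using (_⊎_)
open import Data.Fin using (Fin) renaming (_<_ to _<ᶠ_)
open import Data.Fin.Properties using () renaming (_<?_ to _<ᶠ?_; _≟_ to _≟ᶠ_)
open import Data.Fin.Subset using (Subset; _∈_)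
open import Data.Fin.Subset.Properties using (_∈?_)
open import Data.List using (List; allFin; length; filter; concatMap; [_]; [])
open import Data.Product using (_×_; _,_; proj₁; proj₂)
open import Relation.Binary.PropositionalEquality using (_≡_; refl; sym)
open import Relation.Nullary using (¬_; Dec; yes; no)
open import Relation.Nullary.Decidable using (⌊_⌋)

record Graph (v : ℕ) : Set where
  field
    adj    : Fin v → Fin v → Bool
    adj-sym    : ∀ x y → adj x y ≡ adj y x
    adj-irrefl : ∀ x → adj x x ≡ false
open Graph public

complement : ∀ {v} → Graph v → Graph v
complement G = record
  { adj = λ x y → if ⌊ x ≟ᶠ y ⌋ then false else not (adj G x y)
  ; adj-sym = symC
  ; adj-irrefl = irrC }
  where
  symC : ∀ x y → (if ⌊ x ≟ᶠ y ⌋ then false else not (adj G x y))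
               ≡ (if ⌊ y ≟ᶠ x ⌋ then false else not (adj G y x))
  symC x y with x ≟ᶠ y | y ≟ᶠ x
  ... | yes _ | yes _ = refl
  ... | yes p | no q = ⊥-elim (q (sym p))
  ... | no q | yes p = ⊥-elim (q (sym p))
  ... | no _ | no _ rewrite adj-sym G x y = refl
  irrC : ∀ x → (if ⌊ x ≟ᶠ x ⌋ then false else not (adj G x x)) ≡ false
  irrC x with x ≟ᶠ x
  ... | yes _ = refl
  ... | no n = ⊥-elim (n refl)

pairsIn : ∀ {v} → Subset v → List (Fin v × Fin v)
pairsIn {v} K =
  concatMap (λ x → concatMap (λ y →
     if ⌊ x ∈? K ⌋ ∧ ⌊ y ∈? K ⌋ ∧ ⌊ x <ᶠ? y ⌋ then [ (x , y) ] else [])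
     (allFin v)) (allFin v)

triplesIn : ∀ {v} → Subset v → List (Fin v × Fin v × Fin v)
triplesIn {v} K =
  concatMap (λ x → concatMap (λ y → concatMap (λ z →
     if ⌊ x ∈? K ⌋ ∧ ⌊ y ∈? K ⌋ ∧ ⌊ z ∈? K ⌋ ∧ ⌊ x <ᶠ? y ⌋ ∧ ⌊ y <ᶠ? z ⌋
     then [ (x , y , z) ] else [])
     (allFin v)) (allFin v)) (allFin v)

e↾ : ∀ {v} → Graph v → Subset v → ℕ
e↾ G K = length (filter (λ p → adj G (proj₁ p) (proj₂ p) ≟ᵇ true) (pairsIn K))

homogeneous : ∀ {v} → Graph v → Fin v × Fin v × Fin v → Bool
homogeneous G (x , y , z) =
  (adj G x y ∧ adj G y z ∧ adj G x z) ∨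
  (not (adj G x y) ∧ not (adj G y z) ∧ not (adj G x z))

h3↾ : ∀ {v} → Graph v → Subset v → ℕ
h3↾ G K = length (filter (λ t → homogeneous G t ≟ᵇ true) (triplesIn K))

EdgeCond : ∀ {v} → Graph v → Graph v → Subset v → Set
EdgeCond G G' K = (e↾ G' K ≡ e↾ G K) ⊎ (e↾ G' K ≡ e↾ (complement G) K)

-- Let Q(S) = (e(G'↾S) − e(G↾S)) · (e(G'↾S) − e(Ḡ↾S)), which vanishes exactly when the
-- edge condition holds on S, and D(S) = h⁽³⁾(G'↾S) − h⁽³⁾(G↾S).  Both are local sums: Q(S)
-- is a sum over pairs of edges inside S and D(S) a sum over triangles inside S.  The
-- diagonal terms of Q vanish, so Q = A + B, where A collects the pairs of edges spanning
-- three vertices and B those spanning four.  If every term of a local sum F spans c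
-- vertices, then summing F over the m-subsets of K counts each term C(|K| − c, m − c)
-- times, so the sum equals C(|K| − c, m − c) · F(K).  On a triangle one checks Q = 2D
-- directly; summing over the 3-subsets of K therefore gives A(K) = 2 D(K) when |K| ≥ 4.
-- (ii) ⇒ (i): Q vanishes on K and on its k'-subsets, which by Pascal's rule leaves
-- C(|K| − 4, k' − 3) · A(K) = 0, so D(K) = 0.  (i) ⇒ (iii): the vanishing of D on the
-- k-subsets of L forces D(L) = 0, hence A(L) = 0, and then the vanishing of Q on them
-- forces B(L) = 0.

module Submission where

open import Defs
open import Data.Nat using (ℕ; _≤_; _<_)
open import Data.Fin.Subset using (Subset; ∣_∣)
open import Data.Product using (_×_; ∃-syntax)
open import Data.Sum using (_⊎_)
open import Relation.Binary.PropositionalEquality using (_≡_)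

open import Data.Nat as ℕ using (zero; suc; z≤n; s≤s; z<s; s<s)
import Data.Nat.Properties as ℕ
open import Data.Integer using (ℤ; +_; 0ℤ; 1ℤ; -1ℤ; _+_; _-_; _*_)
open import Data.Integer.Properties as ℤ
  using ( +-*-semiring; +-*-ring; +-commutativeSemigroup; *-commutativeSemigroup
        ; +-identityˡ; +-identityʳ; *-identityˡ; *-zeroʳ; *-assoc; *-comm; *-distribˡ-+
        ; -1*i≡-i; pos-+ )
open import Data.Integer.Tactic.RingSolver using (solve-∀)
open import Data.Bool using (Bool; true; false; _∧_; _∨_; not; if_then_else_)
open import Data.Bool.Properties using (∧-assoc; ∧-zeroʳ) renaming (_≟_ to _≟ᵇ_)
open import Data.Fin using (Fin; zero; suc) renaming (_<_ to _<ᶠ_)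
import Data.Fin.Properties as Fin
open import Data.Fin.Properties using () renaming (_<?_ to _<ᶠ?_)
open import Data.Fin.Subset using (_─_; _∪_; ⁅_⁆; ⊥; _∈_; _∉_)
open import Data.Fin.Subset.Properties using (_∈?_; ∪-identityˡ; ∉⊥; ∣⊥∣≡0; x∈p∪q⁻; x∈⁅y⁆⇒x≡y)
open import Data.Vec using (Vec; []; _∷_; take; drop; lookup; here; there)
open import Data.Vec.Relation.Unary.Any using (Any; here; there)
open import Data.List as List using (List; []; _∷_; [_]; length; filter; concatMap; tabulate; allFin; _++_)
open import Data.List.Properties using (length-++; filter-++; length-map)
open import Data.List.Relation.Unary.Linked as Linked using (Linked; []; [-]; _∷_)
open import Data.List.Relation.Unary.Linked.Properties using (map⁺)
open import Data.Product using (_,_; proj₁; proj₂)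
open import Data.Sum using (inj₁; inj₂)
open import Data.Empty using (⊥-elim)
open import Relation.Binary.PropositionalEquality
  using (_≢_; refl; sym; trans; cong; cong₂; subst; module ≡-Reasoning)
open import Relation.Nullary using (Dec; yes; no; ¬_; does)
open import Relation.Nullary.Decidable using (⌊_⌋; ⌊⌋-map′; toWitness)
open import Relation.Unary using (Pred; Decidable)
open import Level using (0ℓ)
open import Algebra.Properties.CommutativeSemigroup +-commutativeSemigroup
  using () renaming (interchange to +-interchange)
open import Algebra.Properties.CommutativeSemigroup *-commutativeSemigroup
  using () renaming (interchange to *-interchange)
open import Algebra.Properties.Ring +-*-ring using (x[y-z]≈xy-xz)
open import Algebra.Properties.Semiring.Sum +-*-semiring
  using (sum-syntax; sum-cong-≗; ∑-distrib-+; *-distribˡ-sum; *-distribʳ-sum)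

private variable
  v k l c m n : ℕ

⟦_⟧ : Bool → ℤ
⟦ true ⟧  = 1ℤ
⟦ false ⟧ = 0ℤ

⟦∧⟧ : ∀ a b → ⟦ a ∧ b ⟧ ≡ ⟦ a ⟧ * ⟦ b ⟧
⟦∧⟧ true  b = sym (*-identityˡ ⟦ b ⟧)
⟦∧⟧ false b = refl

_<ᵇ_ : Fin v → Fin v → Bool
x <ᵇ y = ⌊ x <ᶠ? y ⌋

_∈ᵇ_ : Fin v → Subset v → Bool
x ∈ᵇ S = lookup S x

_⊆ᵇ_ : Subset v → Subset v → Bool
[]          ⊆ᵇ []      = true
(false ∷ p) ⊆ᵇ (_ ∷ q) = p ⊆ᵇ q
(true ∷ p)  ⊆ᵇ (b ∷ q) = b ∧ (p ⊆ᵇ q)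

∑ᵗ : ∀ k → (Vec (Fin v) k → ℤ) → ℤ
∑ᵗ         zero    f = f []
∑ᵗ {v = v} (suc k) f = ∑[ x < v ] ∑ᵗ k (λ xs → f (x ∷ xs))

∑ᵗ-cong : ∀ k {f g : Vec (Fin v) k → ℤ} → (∀ xs → f xs ≡ g xs) → ∑ᵗ k f ≡ ∑ᵗ k g
∑ᵗ-cong zero    f≗g = f≗g []
∑ᵗ-cong (suc k) f≗g = sum-cong-≗ λ x → ∑ᵗ-cong k λ xs → f≗g (x ∷ xs)

∑ᵗ-distrib-+ : ∀ k (f g : Vec (Fin v) k → ℤ) → ∑ᵗ k (λ xs → f xs + g xs) ≡ ∑ᵗ k f + ∑ᵗ k g
∑ᵗ-distrib-+ zero    f g = refl
∑ᵗ-distrib-+ (suc k) f g =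
  trans (sum-cong-≗ λ x → ∑ᵗ-distrib-+ k (λ xs → f (x ∷ xs)) (λ xs → g (x ∷ xs)))
        (∑-distrib-+ (λ x → ∑ᵗ k (λ xs → f (x ∷ xs))) (λ x → ∑ᵗ k (λ xs → g (x ∷ xs))))

*-distribˡ-∑ᵗ : ∀ k x (f : Vec (Fin v) k → ℤ) → x * ∑ᵗ k f ≡ ∑ᵗ k (λ xs → x * f xs)
*-distribˡ-∑ᵗ zero    x f = refl
*-distribˡ-∑ᵗ (suc k) x f =
  trans (*-distribˡ-sum x (λ y → ∑ᵗ k (λ xs → f (y ∷ xs)))) (sum-cong-≗ λ y → *-distribˡ-∑ᵗ k x λ xs → f (y ∷ xs))

∑ᵗ-distrib-- : ∀ k (f g : Vec (Fin v) k → ℤ) → ∑ᵗ k (λ xs → f xs - g xs) ≡ ∑ᵗ k f - ∑ᵗ k g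
∑ᵗ-distrib-- k f g = begin
  ∑ᵗ k (λ xs → f xs - g xs)          ≡⟨ ∑ᵗ-cong k (λ xs → cong (_+_ (f xs)) (-1*i≡-i (g xs))) ⟨
  ∑ᵗ k (λ xs → f xs + -1ℤ * g xs)    ≡⟨ ∑ᵗ-distrib-+ k f _ ⟩
  ∑ᵗ k f + ∑ᵗ k (λ xs → -1ℤ * g xs)  ≡⟨ cong (_+_ (∑ᵗ k f)) (*-distribˡ-∑ᵗ k -1ℤ g) ⟨
  ∑ᵗ k f + -1ℤ * ∑ᵗ k g              ≡⟨ cong (_+_ (∑ᵗ k f)) (-1*i≡-i (∑ᵗ k g)) ⟩
  ∑ᵗ k f - ∑ᵗ k g                    ∎
  where open ≡-Reasoning

∑ᵗ-* : ∀ k {l} (f : Vec (Fin v) k → ℤ) (g : Vec (Fin v) l → ℤ) →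
       ∑ᵗ k f * ∑ᵗ l g ≡ ∑ᵗ (k ℕ.+ l) (λ zs → f (take k zs) * g (drop k zs))
∑ᵗ-* zero    {l} f g = *-distribˡ-∑ᵗ l (f []) g
∑ᵗ-* (suc k)     f g =
  trans (*-distribʳ-sum (∑ᵗ _ g) (λ x → ∑ᵗ k (λ xs → f (x ∷ xs)))) (sum-cong-≗ λ x → ∑ᵗ-* k (λ xs → f (x ∷ xs)) g)

∑⊆ : Subset v → ℕ → (Subset v → ℤ) → ℤ
∑⊆ []          zero    F = F []
∑⊆ []          (suc m) F = 0ℤ
∑⊆ (false ∷ K) m       F = ∑⊆ K m (λ S → F (false ∷ S))
∑⊆ (true ∷ K)  zero    F = ∑⊆ K zero (λ S → F (false ∷ S))
∑⊆ (true ∷ K)  (suc m) F = ∑⊆ K (suc m) (λ S → F (false ∷ S)) + ∑⊆ K m (λ S → F (true ∷ S))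

∑⊆-cong : ∀ (K : Subset v) m {F G : Subset v → ℤ} →
          (∀ S → ∣ S ∣ ≡ m → F S ≡ G S) → ∑⊆ K m F ≡ ∑⊆ K m G
∑⊆-cong []          zero    F≗G = F≗G [] refl
∑⊆-cong []          (suc m) F≗G = refl
∑⊆-cong (false ∷ K) m       F≗G = ∑⊆-cong K m λ S → F≗G (false ∷ S)
∑⊆-cong (true ∷ K)  zero    F≗G = ∑⊆-cong K zero λ S → F≗G (false ∷ S)
∑⊆-cong (true ∷ K)  (suc m) F≗G =
  cong₂ _+_ (∑⊆-cong K (suc m) λ S → F≗G (false ∷ S))
            (∑⊆-cong K m λ S ∣S∣≡m → F≗G (true ∷ S) (cong suc ∣S∣≡m))

∑⊆-0 : ∀ (K : Subset v) m → ∑⊆ K m (λ _ → 0ℤ) ≡ 0ℤ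
∑⊆-0 []          zero    = refl
∑⊆-0 []          (suc m) = refl
∑⊆-0 (false ∷ K) m       = ∑⊆-0 K m
∑⊆-0 (true ∷ K)  zero    = ∑⊆-0 K zero
∑⊆-0 (true ∷ K)  (suc m) = cong₂ _+_ (∑⊆-0 K (suc m)) (∑⊆-0 K m)

∑⊆-vanishing : ∀ (K : Subset v) m {F} → (∀ S → ∣ S ∣ ≡ m → F S ≡ 0ℤ) → ∑⊆ K m F ≡ 0ℤ
∑⊆-vanishing K m F≡0 = trans (∑⊆-cong K m F≡0) (∑⊆-0 K m)

∑⊆-distrib-+ : ∀ (K : Subset v) m (F G : Subset v → ℤ) →
               ∑⊆ K m (λ S → F S + G S) ≡ ∑⊆ K m F + ∑⊆ K m G
∑⊆-distrib-+ []          zero    F G = refl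
∑⊆-distrib-+ []          (suc m) F G = refl
∑⊆-distrib-+ (false ∷ K) m       F G = ∑⊆-distrib-+ K m (λ S → F (false ∷ S)) (λ S → G (false ∷ S))
∑⊆-distrib-+ (true ∷ K)  zero    F G = ∑⊆-distrib-+ K zero (λ S → F (false ∷ S)) (λ S → G (false ∷ S))
∑⊆-distrib-+ (true ∷ K)  (suc m) F G =
  trans (cong₂ _+_ (∑⊆-distrib-+ K (suc m) (λ S → F (false ∷ S)) (λ S → G (false ∷ S)))
                   (∑⊆-distrib-+ K m (λ S → F (true ∷ S)) (λ S → G (true ∷ S))))
        (+-interchange (∑⊆ K (suc m) (λ S → F (false ∷ S))) (∑⊆ K (suc m) (λ S → G (false ∷ S)))
                       (∑⊆ K m (λ S → F (true ∷ S))) (∑⊆ K m (λ S → G (true ∷ S))))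

*-distribˡ-∑⊆ : ∀ (K : Subset v) m x (F : Subset v → ℤ) → x * ∑⊆ K m F ≡ ∑⊆ K m (λ S → x * F S)
*-distribˡ-∑⊆ []          zero    x F = refl
*-distribˡ-∑⊆ []          (suc m) x F = *-zeroʳ x
*-distribˡ-∑⊆ (false ∷ K) m       x F = *-distribˡ-∑⊆ K m x (λ S → F (false ∷ S))
*-distribˡ-∑⊆ (true ∷ K)  zero    x F = *-distribˡ-∑⊆ K zero x (λ S → F (false ∷ S))
*-distribˡ-∑⊆ (true ∷ K)  (suc m) x F =
  trans (*-distribˡ-+ x _ _)
        (cong₂ _+_ (*-distribˡ-∑⊆ K (suc m) x (λ S → F (false ∷ S))) (*-distribˡ-∑⊆ K m x (λ S → F (true ∷ S))))

*-distribʳ-∑⊆ : ∀ (K : Subset v) m x (F : Subset v → ℤ) → ∑⊆ K m F * x ≡ ∑⊆ K m (λ S → F S * x)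
*-distribʳ-∑⊆ K m x F =
  trans (*-comm (∑⊆ K m F) x) (trans (*-distribˡ-∑⊆ K m x F) (∑⊆-cong K m λ S _ → *-comm x (F S)))

∑⊆-∑-comm : ∀ (K : Subset v) m {n} (f : Subset v → Fin n → ℤ) →
            ∑⊆ K m (λ S → ∑[ i < n ] f S i) ≡ ∑[ i < n ] ∑⊆ K m (λ S → f S i)
∑⊆-∑-comm K m {zero}  f = ∑⊆-0 K m
∑⊆-∑-comm K m {suc n} f =
  trans (∑⊆-distrib-+ K m (λ S → f S zero) (λ S → ∑[ i < n ] f S (suc i)))
        (cong (_+_ (∑⊆ K m (λ S → f S zero))) (∑⊆-∑-comm K m (λ S i → f S (suc i))))

∑⊆-∑ᵗ-comm : ∀ (K : Subset v) m k (f : Subset v → Vec (Fin v) k → ℤ) →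
             ∑⊆ K m (λ S → ∑ᵗ k (f S)) ≡ ∑ᵗ k (λ xs → ∑⊆ K m (λ S → f S xs))
∑⊆-∑ᵗ-comm K m zero    f = refl
∑⊆-∑ᵗ-comm K m (suc k) f =
  trans (∑⊆-∑-comm K m (λ S x → ∑ᵗ k (λ xs → f S (x ∷ xs)))) (sum-cong-≗ λ x → ∑⊆-∑ᵗ-comm K m k λ S xs → f S (x ∷ xs))

-- supersets n c m is the number of m-sets S with T ⊆ S ⊆ K, where ∣ T ∣ = c and ∣ K ─ T ∣ = n:
-- a point of K ─ T is either left out of S or moved into T.
supersets : ℕ → ℕ → ℕ → ℕ
supersets zero    zero    zero    = 1
supersets zero    zero    (suc m) = 0
supersets zero    (suc c) zero    = 0
supersets zero    (suc c) (suc m) = supersets zero c m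
supersets (suc n) c       m       = supersets n c m ℕ.+ supersets n (suc c) m

supersets-shift : ∀ n c m → supersets n (suc c) (suc m) ≡ supersets n c m
supersets-shift zero    c m = refl
supersets-shift (suc n) c m = cong₂ ℕ._+_ (supersets-shift n c m) (supersets-shift n (suc c) m)

supersets-empty : ∀ n c → supersets n (suc c) zero ≡ 0
supersets-empty zero    c = refl
supersets-empty (suc n) c = cong₂ ℕ._+_ (supersets-empty n c) (supersets-empty n (suc c))

supersets-below : ∀ n {c m} → m < c → supersets n c m ≡ 0
supersets-below n {suc c} {zero}  _         = supersets-empty n c
supersets-below n {suc c} {suc m} (s≤s m<c) = trans (supersets-shift n c m) (supersets-below n m<c)

supersets-diagonal : ∀ n c → supersets n c c ≡ 1
supersets-diagonal zero    zero    = refl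
supersets-diagonal (suc n) zero    = cong₂ ℕ._+_ (supersets-diagonal n zero) (supersets-empty n zero)
supersets-diagonal n       (suc c) = trans (supersets-shift n c c) (supersets-diagonal n c)

supersets-positive : ∀ n {c m} → c ≤ m → m ≤ c ℕ.+ n → 0 < supersets n c m
supersets-positive zero {c} c≤m m≤c+0
  rewrite ℕ.≤-antisym (ℕ.≤-trans m≤c+0 (ℕ.≤-reflexive (ℕ.+-identityʳ c))) c≤m
  = subst (0 <_) (sym (supersets-diagonal zero c)) (s≤s z≤n)
supersets-positive (suc n) {c} {m} c≤m m≤c+1+n with m ℕ.≤? c ℕ.+ n
... | yes m≤c+n = ℕ.<-≤-trans (supersets-positive n c≤m m≤c+n) (ℕ.m≤m+n _ _)
... | no  m≰c+n = ℕ.<-≤-trans (supersets-positive n c<m m≤1+c+n) (ℕ.m≤n+m _ _)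
  where
  c<m : suc c ≤ m
  c<m = ℕ.≤-<-trans (ℕ.m≤m+n c n) (ℕ.≰⇒> m≰c+n)
  m≤1+c+n : m ≤ suc c ℕ.+ n
  m≤1+c+n = ℕ.≤-trans m≤c+1+n (ℕ.≤-reflexive (ℕ.+-suc c n))

∣T∣+∣K─T∣≡∣K∣ : ∀ (T K : Subset v) → T ⊆ᵇ K ≡ true → ∣ T ∣ ℕ.+ ∣ K ─ T ∣ ≡ ∣ K ∣
∣T∣+∣K─T∣≡∣K∣ []          []          _    = refl
∣T∣+∣K─T∣≡∣K∣ (false ∷ T) (false ∷ K) T⊆K = ∣T∣+∣K─T∣≡∣K∣ T K T⊆K
∣T∣+∣K─T∣≡∣K∣ (false ∷ T) (true ∷ K)  T⊆K =
  trans (ℕ.+-suc ∣ T ∣ ∣ K ─ T ∣) (cong suc (∣T∣+∣K─T∣≡∣K∣ T K T⊆K))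
∣T∣+∣K─T∣≡∣K∣ (true ∷ T)  (true ∷ K)  T⊆K = cong suc (∣T∣+∣K─T∣≡∣K∣ T K T⊆K)

∑⊆-supersets : ∀ (K T : Subset v) m →
  ∑⊆ K m (λ S → ⟦ T ⊆ᵇ S ⟧) ≡ ⟦ T ⊆ᵇ K ⟧ * + supersets (∣ K ─ T ∣) (∣ T ∣) m
∑⊆-supersets []          []          zero    = refl
∑⊆-supersets []          []          (suc m) = refl
∑⊆-supersets (false ∷ K) (false ∷ T) m       = ∑⊆-supersets K T m
∑⊆-supersets (false ∷ K) (true ∷ T)  m       = ∑⊆-0 K m
∑⊆-supersets (true ∷ K)  (false ∷ T) zero    = begin
  ∑⊆ K zero (λ S → ⟦ T ⊆ᵇ S ⟧)
    ≡⟨ ∑⊆-supersets K T zero ⟩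
  ⟦ T ⊆ᵇ K ⟧ * + supersets (∣ K ─ T ∣) (∣ T ∣) zero
    ≡⟨ cong (λ s → ⟦ T ⊆ᵇ K ⟧ * + s) (ℕ.+-identityʳ _) ⟨
  ⟦ T ⊆ᵇ K ⟧ * + (supersets (∣ K ─ T ∣) (∣ T ∣) zero ℕ.+ 0)
    ≡⟨ cong (λ s → ⟦ T ⊆ᵇ K ⟧ * + (supersets (∣ K ─ T ∣) (∣ T ∣) zero ℕ.+ s)) (supersets-empty (∣ K ─ T ∣) ∣ T ∣) ⟨
  ⟦ T ⊆ᵇ K ⟧ * + supersets (suc ∣ K ─ T ∣) ∣ T ∣ zero ∎
  where open ≡-Reasoning
∑⊆-supersets (true ∷ K)  (false ∷ T) (suc m) = begin
  ∑⊆ K (suc m) (λ S → ⟦ T ⊆ᵇ S ⟧) + ∑⊆ K m (λ S → ⟦ T ⊆ᵇ S ⟧)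
    ≡⟨ cong₂ _+_ (∑⊆-supersets K T (suc m)) (∑⊆-supersets K T m) ⟩
  ⟦ T ⊆ᵇ K ⟧ * + supersets d t (suc m) + ⟦ T ⊆ᵇ K ⟧ * + supersets d t m
    ≡⟨ *-distribˡ-+ ⟦ T ⊆ᵇ K ⟧ _ _ ⟨
  ⟦ T ⊆ᵇ K ⟧ * (+ supersets d t (suc m) + + supersets d t m)
    ≡⟨ cong (⟦ T ⊆ᵇ K ⟧ *_) (pos-+ (supersets d t (suc m)) _) ⟨
  ⟦ T ⊆ᵇ K ⟧ * + (supersets d t (suc m) ℕ.+ supersets d t m)
    ≡⟨ cong (λ s → ⟦ T ⊆ᵇ K ⟧ * + (supersets d t (suc m) ℕ.+ s)) (supersets-shift d t m) ⟨
  ⟦ T ⊆ᵇ K ⟧ * + supersets (suc d) t (suc m) ∎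
  where
  open ≡-Reasoning
  d t : ℕ
  d = ∣ K ─ T ∣
  t = ∣ T ∣
∑⊆-supersets (true ∷ K)  (true ∷ T)  zero    = begin
  ∑⊆ K zero (λ _ → 0ℤ)                              ≡⟨ ∑⊆-0 K zero ⟩
  0ℤ                                                ≡⟨ *-zeroʳ ⟦ T ⊆ᵇ K ⟧ ⟨
  ⟦ T ⊆ᵇ K ⟧ * 0ℤ                                   ≡⟨ cong (λ s → ⟦ T ⊆ᵇ K ⟧ * + s) (supersets-empty (∣ K ─ T ∣) ∣ T ∣) ⟨
  ⟦ T ⊆ᵇ K ⟧ * + supersets (∣ K ─ T ∣) (suc ∣ T ∣) zero ∎
  where open ≡-Reasoning
∑⊆-supersets (true ∷ K)  (true ∷ T)  (suc m) = begin
  ∑⊆ K (suc m) (λ _ → 0ℤ) + ∑⊆ K m (λ S → ⟦ T ⊆ᵇ S ⟧)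
    ≡⟨ cong₂ _+_ (∑⊆-0 K (suc m)) (∑⊆-supersets K T m) ⟩
  0ℤ + ⟦ T ⊆ᵇ K ⟧ * + supersets (∣ K ─ T ∣) (∣ T ∣) m
    ≡⟨ +-identityˡ _ ⟩
  ⟦ T ⊆ᵇ K ⟧ * + supersets (∣ K ─ T ∣) (∣ T ∣) m
    ≡⟨ cong (λ s → ⟦ T ⊆ᵇ K ⟧ * + s) (supersets-shift (∣ K ─ T ∣) ∣ T ∣ m) ⟨
  ⟦ T ⊆ᵇ K ⟧ * + supersets (∣ K ─ T ∣) (suc ∣ T ∣) (suc m) ∎
  where open ≡-Reasoning

⊥⊆ᵇ : ∀ (S : Subset v) → ⊥ ⊆ᵇ S ≡ true
⊥⊆ᵇ []      = refl
⊥⊆ᵇ (_ ∷ S) = ⊥⊆ᵇ S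

⁅x⁆∪p⊆ᵇS : ∀ (x : Fin v) p S → (⁅ x ⁆ ∪ p) ⊆ᵇ S ≡ x ∈ᵇ S ∧ p ⊆ᵇ S
⁅x⁆∪p⊆ᵇS zero    (b ∷ p)     (s ∷ S) rewrite ∪-identityˡ p with b | s
... | false | s     = refl
... | true  | true  = refl
... | true  | false = refl
⁅x⁆∪p⊆ᵇS (suc x) (false ∷ p) (s ∷ S) = ⁅x⁆∪p⊆ᵇS x p S
⁅x⁆∪p⊆ᵇS (suc x) (true ∷ p)  (s ∷ S) with s
... | true  = ⁅x⁆∪p⊆ᵇS x p S
... | false = sym (∧-zeroʳ (x ∈ᵇ S))

setOf : Vec (Fin v) k → Subset v
setOf []       = ⊥
setOf (x ∷ xs) = ⁅ x ⁆ ∪ setOf xs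

setOf⊆ᵇ-∷ : ∀ {k} (x : Fin v) (xs : Vec (Fin v) k) S → setOf (x ∷ xs) ⊆ᵇ S ≡ x ∈ᵇ S ∧ setOf xs ⊆ᵇ S
setOf⊆ᵇ-∷ x xs S = ⁅x⁆∪p⊆ᵇS x (setOf xs) S

⟦setOf⊆⟧-splitAt : ∀ k {l} (zs : Vec (Fin v) (k ℕ.+ l)) S →
  ⟦ setOf zs ⊆ᵇ S ⟧ ≡ ⟦ setOf (take k zs) ⊆ᵇ S ⟧ * ⟦ setOf (drop k zs) ⊆ᵇ S ⟧
⟦setOf⊆⟧-splitAt zero    zs       S rewrite ⊥⊆ᵇ S = sym (*-identityˡ _)
⟦setOf⊆⟧-splitAt (suc k) (x ∷ zs) S = begin
  ⟦ (⁅ x ⁆ ∪ setOf zs) ⊆ᵇ S ⟧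
    ≡⟨ cong ⟦_⟧ (⁅x⁆∪p⊆ᵇS x (setOf zs) S) ⟩
  ⟦ x ∈ᵇ S ∧ setOf zs ⊆ᵇ S ⟧
    ≡⟨ ⟦∧⟧ (x ∈ᵇ S) _ ⟩
  ⟦ x ∈ᵇ S ⟧ * ⟦ setOf zs ⊆ᵇ S ⟧
    ≡⟨ cong (⟦ x ∈ᵇ S ⟧ *_) (⟦setOf⊆⟧-splitAt k zs S) ⟩
  ⟦ x ∈ᵇ S ⟧ * (⟦ setOf (take k zs) ⊆ᵇ S ⟧ * ⟦ setOf (drop k zs) ⊆ᵇ S ⟧)
    ≡⟨ *-assoc ⟦ x ∈ᵇ S ⟧ ⟦ setOf (take k zs) ⊆ᵇ S ⟧ ⟦ setOf (drop k zs) ⊆ᵇ S ⟧ ⟨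
  ⟦ x ∈ᵇ S ⟧ * ⟦ setOf (take k zs) ⊆ᵇ S ⟧ * ⟦ setOf (drop k zs) ⊆ᵇ S ⟧
    ≡⟨ cong (_* ⟦ setOf (drop k zs) ⊆ᵇ S ⟧) (⟦∧⟧ (x ∈ᵇ S) _) ⟨
  ⟦ x ∈ᵇ S ∧ setOf (take k zs) ⊆ᵇ S ⟧ * ⟦ setOf (drop k zs) ⊆ᵇ S ⟧
    ≡⟨ cong (λ b → ⟦ b ⟧ * ⟦ setOf (drop k zs) ⊆ᵇ S ⟧) (⁅x⁆∪p⊆ᵇS x (setOf (take k zs)) S) ⟨
  ⟦ (⁅ x ⁆ ∪ setOf (take k zs)) ⊆ᵇ S ⟧ * ⟦ setOf (drop k zs) ⊆ᵇ S ⟧ ∎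
  where open ≡-Reasoning

-- Local sums

localSum : (Vec (Fin v) k → ℤ) → Subset v → ℤ
localSum {k = k} a S = ∑ᵗ k (λ xs → ⟦ setOf xs ⊆ᵇ S ⟧ * a xs)

localSum-cong : ∀ {a b : Vec (Fin v) k → ℤ} → (∀ xs → a xs ≡ b xs) → ∀ S → localSum a S ≡ localSum b S
localSum-cong {k = k} a≗b S = ∑ᵗ-cong k λ xs → cong (⟦ setOf xs ⊆ᵇ S ⟧ *_) (a≗b xs)

localSum-+ : ∀ (a b : Vec (Fin v) k → ℤ) S → localSum (λ xs → a xs + b xs) S ≡ localSum a S + localSum b S
localSum-+ {k = k} a b S =
  trans (∑ᵗ-cong k λ xs → *-distribˡ-+ ⟦ setOf xs ⊆ᵇ S ⟧ (a xs) (b xs)) (∑ᵗ-distrib-+ k _ _)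

localSum-- : ∀ (a b : Vec (Fin v) k → ℤ) S → localSum (λ xs → a xs - b xs) S ≡ localSum a S - localSum b S
localSum-- {k = k} a b S =
  trans (∑ᵗ-cong k λ xs → x[y-z]≈xy-xz ⟦ setOf xs ⊆ᵇ S ⟧ (a xs) (b xs)) (∑ᵗ-distrib-- k _ _)

_⊗_ : (Vec (Fin v) k → ℤ) → (Vec (Fin v) l → ℤ) → Vec (Fin v) (k ℕ.+ l) → ℤ
_⊗_ {k = k} a b zs = a (take k zs) * b (drop k zs)

localSum-* : ∀ (a : Vec (Fin v) k → ℤ) (b : Vec (Fin v) l → ℤ) S →
             localSum a S * localSum b S ≡ localSum (a ⊗ b) S
localSum-* {k = k} {l = l} a b S =
  trans (∑ᵗ-* k (λ xs → ⟦ setOf xs ⊆ᵇ S ⟧ * a xs) (λ ys → ⟦ setOf ys ⊆ᵇ S ⟧ * b ys))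
        (∑ᵗ-cong (k ℕ.+ l) λ zs →
          trans (*-interchange ⟦ setOf (take k zs) ⊆ᵇ S ⟧ (a (take k zs)) ⟦ setOf (drop k zs) ⊆ᵇ S ⟧ (b (drop k zs)))
                (cong (_* (a ⊗ b) zs) (sym (⟦setOf⊆⟧-splitAt k zs S))))

restrict : ℕ → (Vec (Fin v) k → ℤ) → Vec (Fin v) k → ℤ
restrict c a xs = if ⌊ ∣ setOf xs ∣ ℕ.≟ c ⌋ then a xs else 0ℤ

restrict-exact : ∀ c (a : Vec (Fin v) k → ℤ) xs → a xs ≡ 0ℤ ⊎ ∣ setOf xs ∣ ≡ c → a xs ≡ restrict c a xs
restrict-exact c a xs support with ∣ setOf xs ∣ ℕ.≟ c | support
... | yes _     | _          = refl
... | no _      | inj₁ a≡0   = a≡0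
... | no ∣xs∣≢c | inj₂ ∣xs∣≡c = ⊥-elim (∣xs∣≢c ∣xs∣≡c)

restrict-split : ∀ c d (a : Vec (Fin v) k → ℤ) xs → c ≢ d →
  a xs ≡ 0ℤ ⊎ (∣ setOf xs ∣ ≡ c ⊎ ∣ setOf xs ∣ ≡ d) → a xs ≡ restrict c a xs + restrict d a xs
restrict-split c d a xs c≢d support with ∣ setOf xs ∣ ℕ.≟ c | ∣ setOf xs ∣ ℕ.≟ d | support
... | yes refl | yes refl | _                = ⊥-elim (c≢d refl)
... | yes _    | no _     | _                = sym (+-identityʳ (a xs))
... | no _     | yes _    | _                = sym (+-identityˡ (a xs))
... | no _     | no _     | inj₁ a≡0         = a≡0
... | no ≢c    | no _     | inj₂ (inj₁ ≡c)   = ⊥-elim (≢c ≡c)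
... | no _     | no ≢d    | inj₂ (inj₂ ≡d)   = ⊥-elim (≢d ≡d)

supersets-restricted : ∀ {v k} (K : Subset v) c n m (a : Vec (Fin v) k → ℤ) xs → ∣ K ∣ ≡ c ℕ.+ n →
  ⟦ setOf xs ⊆ᵇ K ⟧ * + supersets (∣ K ─ setOf xs ∣) (∣ setOf xs ∣) m * restrict c a xs
    ≡ + supersets n c m * (⟦ setOf xs ⊆ᵇ K ⟧ * restrict c a xs)
supersets-restricted {v} K c n m a xs ∣K∣≡c+n with ∣ setOf xs ∣ ℕ.≟ c | setOf xs ⊆ᵇ K in T⊆K
... | no _     | b     = begin
  ⟦ b ⟧ * + supersets (∣ K ─ T ∣) (∣ T ∣) m * 0ℤ  ≡⟨ *-zeroʳ (⟦ b ⟧ * + supersets (∣ K ─ T ∣) (∣ T ∣) m) ⟩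
  0ℤ                                           ≡⟨ *-zeroʳ (+ supersets n c m) ⟨
  + supersets n c m * 0ℤ                       ≡⟨ cong (+ supersets n c m *_) (*-zeroʳ ⟦ b ⟧) ⟨
  + supersets n c m * (⟦ b ⟧ * 0ℤ)              ∎
  where
  open ≡-Reasoning
  T : Subset v
  T = setOf xs
... | yes _    | false = sym (*-zeroʳ (+ supersets n c m))
... | yes refl | true  = begin
  1ℤ * + supersets (∣ K ─ T ∣) (∣ T ∣) m * a xs  ≡⟨ cong (_* a xs) (*-identityˡ (+ supersets (∣ K ─ T ∣) (∣ T ∣) m)) ⟩
  + supersets (∣ K ─ T ∣) (∣ T ∣) m * a xs       ≡⟨ cong (λ d → + supersets d (∣ T ∣) m * a xs) ∣K─T∣≡n ⟩
  + supersets n (∣ T ∣) m * a xs                 ≡⟨ cong (+ supersets n (∣ T ∣) m *_) (*-identityˡ (a xs)) ⟨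
  + supersets n (∣ T ∣) m * (1ℤ * a xs)          ∎
  where
  open ≡-Reasoning
  T : Subset v
  T = setOf xs
  ∣K─T∣≡n : ∣ K ─ T ∣ ≡ n
  ∣K─T∣≡n = ℕ.+-cancelˡ-≡ ∣ T ∣ _ _ (trans (∣T∣+∣K─T∣≡∣K∣ T K T⊆K) ∣K∣≡c+n)

∑⊆-localSum : ∀ (a : Vec (Fin v) k → ℤ) (K : Subset v) c n m → ∣ K ∣ ≡ c ℕ.+ n →
  ∑⊆ K m (localSum (restrict c a)) ≡ + supersets n c m * localSum (restrict c a) K
∑⊆-localSum {k = k} a K c n m ∣K∣≡c+n = begin
  ∑⊆ K m (localSum (restrict c a))
    ≡⟨ ∑⊆-∑ᵗ-comm K m k (λ S xs → ⟦ setOf xs ⊆ᵇ S ⟧ * restrict c a xs) ⟩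
  ∑ᵗ k (λ xs → ∑⊆ K m (λ S → ⟦ setOf xs ⊆ᵇ S ⟧ * restrict c a xs))
    ≡⟨ ∑ᵗ-cong k count ⟩
  ∑ᵗ k (λ xs → + supersets n c m * (⟦ setOf xs ⊆ᵇ K ⟧ * restrict c a xs))
    ≡⟨ *-distribˡ-∑ᵗ k (+ supersets n c m) (λ xs → ⟦ setOf xs ⊆ᵇ K ⟧ * restrict c a xs) ⟨
  + supersets n c m * localSum (restrict c a) K ∎
  where
  open ≡-Reasoning
  count : ∀ xs → ∑⊆ K m (λ S → ⟦ setOf xs ⊆ᵇ S ⟧ * restrict c a xs)
                   ≡ + supersets n c m * (⟦ setOf xs ⊆ᵇ K ⟧ * restrict c a xs)
  count xs = begin
    ∑⊆ K m (λ S → ⟦ setOf xs ⊆ᵇ S ⟧ * restrict c a xs)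
      ≡⟨ *-distribʳ-∑⊆ K m (restrict c a xs) (λ S → ⟦ setOf xs ⊆ᵇ S ⟧) ⟨
    ∑⊆ K m (λ S → ⟦ setOf xs ⊆ᵇ S ⟧) * restrict c a xs
      ≡⟨ cong (_* restrict c a xs) (∑⊆-supersets K (setOf xs) m) ⟩
    ⟦ setOf xs ⊆ᵇ K ⟧ * + supersets (∣ K ─ setOf xs ∣) (∣ setOf xs ∣) m * restrict c a xs
      ≡⟨ supersets-restricted K c n m a xs ∣K∣≡c+n ⟩
    + supersets n c m * (⟦ setOf xs ⊆ᵇ K ⟧ * restrict c a xs) ∎

∣⁅x⁆∪p∣-∈ : ∀ (x : Fin v) p → x ∈ p → ∣ ⁅ x ⁆ ∪ p ∣ ≡ ∣ p ∣
∣⁅x⁆∪p∣-∈ zero    (true ∷ p)  here        = cong (λ q → suc ∣ q ∣) (∪-identityˡ p)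
∣⁅x⁆∪p∣-∈ (suc x) (true ∷ p)  (there x∈p) = cong suc (∣⁅x⁆∪p∣-∈ x p x∈p)
∣⁅x⁆∪p∣-∈ (suc x) (false ∷ p) (there x∈p) = ∣⁅x⁆∪p∣-∈ x p x∈p

∣⁅x⁆∪p∣-∉ : ∀ (x : Fin v) p → x ∉ p → ∣ ⁅ x ⁆ ∪ p ∣ ≡ suc ∣ p ∣
∣⁅x⁆∪p∣-∉ zero    (true ∷ p)  x∉p = ⊥-elim (x∉p here)
∣⁅x⁆∪p∣-∉ zero    (false ∷ p) x∉p = cong (λ q → suc ∣ q ∣) (∪-identityˡ p)
∣⁅x⁆∪p∣-∉ (suc x) (true ∷ p)  x∉p = cong suc (∣⁅x⁆∪p∣-∉ x p (λ x∈p → x∉p (there x∈p)))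
∣⁅x⁆∪p∣-∉ (suc x) (false ∷ p) x∉p = ∣⁅x⁆∪p∣-∉ x p (λ x∈p → x∉p (there x∈p))

∈setOf⁻ : ∀ {k} {x : Fin v} (ys : Vec (Fin v) k) → x ∈ setOf ys → Any (x ≡_) ys
∈setOf⁻ []       x∈ = ⊥-elim (∉⊥ x∈)
∈setOf⁻ (y ∷ ys) x∈ with x∈p∪q⁻ ⁅ y ⁆ (setOf ys) x∈
... | inj₁ x∈⁅y⁆ = here (x∈⁅y⁆⇒x≡y y x∈⁅y⁆)
... | inj₂ x∈ys  = there (∈setOf⁻ ys x∈ys)

∣setOf-singleton∣ : ∀ (x : Fin v) → ∣ setOf (x ∷ []) ∣ ≡ 1
∣setOf-singleton∣ {v} x = trans (∣⁅x⁆∪p∣-∉ x ⊥ ∉⊥) (cong suc (∣⊥∣≡0 v))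

∣setOf-increasing-pair∣ : ∀ {x y : Fin v} → x <ᶠ y → ∣ setOf (x ∷ y ∷ []) ∣ ≡ 2
∣setOf-increasing-pair∣ {x = x} {y} x<y = trans (∣⁅x⁆∪p∣-∉ x _ x∉) (cong suc (∣setOf-singleton∣ y))
  where
  x∉ : x ∉ setOf (y ∷ [])
  x∉ x∈ with ∈setOf⁻ (y ∷ []) x∈
  ... | here refl = Fin.<-irrefl refl x<y

∣setOf-increasing-triple∣ : ∀ {x y z : Fin v} → x <ᶠ y → y <ᶠ z → ∣ setOf (x ∷ y ∷ z ∷ []) ∣ ≡ 3
∣setOf-increasing-triple∣ {x = x} {y} {z} x<y y<z =
  trans (∣⁅x⁆∪p∣-∉ x _ x∉) (cong suc (∣setOf-increasing-pair∣ y<z))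
  where
  x∉ : x ∉ setOf (y ∷ z ∷ [])
  x∉ x∈ with ∈setOf⁻ (y ∷ z ∷ []) x∈
  ... | here refl         = Fin.<-irrefl refl x<y
  ... | there (here refl) = Fin.<-irrefl refl (Fin.<-trans x<y y<z)

∣setOf-two-pairs∣ : ∀ {x y z w : Fin v} → x <ᶠ y → z <ᶠ w →
  (x ≡ z × y ≡ w) ⊎ (∣ setOf (x ∷ y ∷ z ∷ w ∷ []) ∣ ≡ 3 ⊎ ∣ setOf (x ∷ y ∷ z ∷ w ∷ []) ∣ ≡ 4)
∣setOf-two-pairs∣ {x = x} {y} {z} {w} x<y z<w with y ∈? setOf (z ∷ w ∷ []) | x ∈? setOf (y ∷ z ∷ w ∷ [])
... | yes y∈ | yes x∈ = inj₁ (coincide (∈setOf⁻ _ y∈) (∈setOf⁻ _ x∈))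
  where
  coincide : Any (y ≡_) (z ∷ w ∷ []) → Any (x ≡_) (y ∷ z ∷ w ∷ []) → x ≡ z × y ≡ w
  coincide _                 (here refl)                 = ⊥-elim (Fin.<-irrefl refl x<y)
  coincide (here refl)       (there (here refl))         = ⊥-elim (Fin.<-irrefl refl x<y)
  coincide (here refl)       (there (there (here refl))) = ⊥-elim (Fin.<-asym x<y z<w)
  coincide (there (here refl)) (there (here refl))       = refl , refl
  coincide (there (here refl)) (there (there (here refl))) = ⊥-elim (Fin.<-irrefl refl x<y)
... | yes y∈ | no x∉ = inj₂ (inj₁ (trans (∣⁅x⁆∪p∣-∉ x _ x∉)
                        (cong suc (trans (∣⁅x⁆∪p∣-∈ y _ y∈) (∣setOf-increasing-pair∣ z<w)))))
... | no y∉  | yes x∈ = inj₂ (inj₁ (trans (∣⁅x⁆∪p∣-∈ x _ x∈)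
                        (trans (∣⁅x⁆∪p∣-∉ y _ y∉) (cong suc (∣setOf-increasing-pair∣ z<w)))))
... | no y∉  | no x∉  = inj₂ (inj₂ (trans (∣⁅x⁆∪p∣-∉ x _ x∉)
                        (cong suc (trans (∣⁅x⁆∪p∣-∉ y _ y∉) (cong suc (∣setOf-increasing-pair∣ z<w))))))

elements : Subset v → List (Fin v)
elements []          = []
elements (true ∷ S)  = zero ∷ List.map suc (elements S)
elements (false ∷ S) = List.map suc (elements S)

length-elements : ∀ (S : Subset v) → length (elements S) ≡ ∣ S ∣
length-elements []          = refl
length-elements (true ∷ S)  = cong suc (trans (length-map suc (elements S)) (length-elements S))
length-elements (false ∷ S) = trans (length-map suc (elements S)) (length-elements S)

elements-increasing : ∀ (S : Subset v) → Linked _<ᶠ_ (elements S)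
elements-increasing []          = []
elements-increasing (false ∷ S) = map⁺ (Linked.map s<s (elements-increasing S))
elements-increasing (true ∷ S) with elements S | elements-increasing S
... | []     | _  = [-]
... | x ∷ xs | xs↑ = z<s ∷ map⁺ (Linked.map s<s xs↑)

∑ᴸ : List (Fin v) → (Fin v → ℤ) → ℤ
∑ᴸ []       f = 0ℤ
∑ᴸ (x ∷ xs) f = f x + ∑ᴸ xs f

∑ᴸ-map-suc : ∀ (xs : List (Fin v)) f → ∑ᴸ (List.map suc xs) f ≡ ∑ᴸ xs (λ x → f (suc x))
∑ᴸ-map-suc []       f = refl
∑ᴸ-map-suc (x ∷ xs) f = cong (_+_ (f (suc x))) (∑ᴸ-map-suc xs f)

∑-elements : ∀ (S : Subset v) f → ∑[ x < v ] (⟦ x ∈ᵇ S ⟧ * f x) ≡ ∑ᴸ (elements S) f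
∑-elements []          f = refl
∑-elements (true ∷ S)  f =
  cong₂ _+_ (*-identityˡ (f zero)) (trans (∑-elements S (λ x → f (suc x))) (sym (∑ᴸ-map-suc (elements S) f)))
∑-elements (false ∷ S) f =
  trans (+-identityˡ _) (trans (∑-elements S (λ x → f (suc x))) (sym (∑ᴸ-map-suc (elements S) f)))

∑ᴸᵗ : List (Fin v) → ∀ k → (Vec (Fin v) k → ℤ) → ℤ
∑ᴸᵗ l zero    f = f []
∑ᴸᵗ l (suc k) f = ∑ᴸ l (λ x → ∑ᴸᵗ l k (λ xs → f (x ∷ xs)))

localSum-elements : ∀ k (a : Vec (Fin v) k → ℤ) S → localSum a S ≡ ∑ᴸᵗ (elements S) k a
localSum-elements zero    a S rewrite ⊥⊆ᵇ S = *-identityˡ (a [])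
localSum-elements {v} (suc k) a S = begin
  ∑[ x < v ] ∑ᵗ k (λ xs → ⟦ setOf (x ∷ xs) ⊆ᵇ S ⟧ * a (x ∷ xs))
    ≡⟨ sum-cong-≗ (λ x → ∑ᵗ-cong k λ xs → split x xs) ⟩
  ∑[ x < v ] ∑ᵗ k (λ xs → ⟦ x ∈ᵇ S ⟧ * (⟦ setOf xs ⊆ᵇ S ⟧ * a (x ∷ xs)))
    ≡⟨ sum-cong-≗ (λ x → *-distribˡ-∑ᵗ k ⟦ x ∈ᵇ S ⟧ _) ⟨
  ∑[ x < v ] (⟦ x ∈ᵇ S ⟧ * localSum (λ xs → a (x ∷ xs)) S)
    ≡⟨ sum-cong-≗ (λ x → cong (⟦ x ∈ᵇ S ⟧ *_) (localSum-elements k (λ xs → a (x ∷ xs)) S)) ⟩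
  ∑[ x < v ] (⟦ x ∈ᵇ S ⟧ * ∑ᴸᵗ (elements S) k (λ xs → a (x ∷ xs)))
    ≡⟨ ∑-elements S _ ⟩
  ∑ᴸᵗ (elements S) (suc k) a ∎
  where
  open ≡-Reasoning
  split : ∀ x xs → ⟦ setOf (x ∷ xs) ⊆ᵇ S ⟧ * a (x ∷ xs) ≡ ⟦ x ∈ᵇ S ⟧ * (⟦ setOf xs ⊆ᵇ S ⟧ * a (x ∷ xs))
  split x xs = trans (cong (λ b → ⟦ b ⟧ * a (x ∷ xs)) (setOf⊆ᵇ-∷ x xs S))
                     (trans (cong (_* a (x ∷ xs)) (⟦∧⟧ (x ∈ᵇ S) _)) (*-assoc ⟦ x ∈ᵇ S ⟧ ⟦ setOf xs ⊆ᵇ S ⟧ (a (x ∷ xs))))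

three-elements : ∀ (S : Subset v) → ∣ S ∣ ≡ 3 →
  ∃[ a ] ∃[ b ] ∃[ c ] (a <ᶠ b × b <ᶠ c × elements S ≡ a ∷ b ∷ c ∷ [])
three-elements S ∣S∣≡3 with elements S | trans (length-elements S) ∣S∣≡3 | elements-increasing S
... | a ∷ b ∷ c ∷ [] | refl | a<b ∷ b<c ∷ [-] = a , b , c , a<b , b<c , refl

⟦<ᵇ⟧-yes : ∀ {x y : Fin v} → x <ᶠ y → ⟦ x <ᵇ y ⟧ ≡ 1ℤ
⟦<ᵇ⟧-yes {x = x} {y} x<y with x <ᶠ? y
... | yes _   = refl
... | no x≮y = ⊥-elim (x≮y x<y)

⟦<ᵇ⟧-no : ∀ {x y : Fin v} → ¬ x <ᶠ y → ⟦ x <ᵇ y ⟧ ≡ 0ℤ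
⟦<ᵇ⟧-no {x = x} {y} x≮y with x <ᶠ? y
... | yes x<y = ⊥-elim (x≮y x<y)
... | no _    = refl

∑ᴸ-cong : ∀ (l : List (Fin v)) {f g : Fin v → ℤ} → (∀ x → f x ≡ g x) → ∑ᴸ l f ≡ ∑ᴸ l g
∑ᴸ-cong []      f≗g = refl
∑ᴸ-cong (x ∷ l) f≗g = cong₂ _+_ (f≗g x) (∑ᴸ-cong l f≗g)

*-distribˡ-∑ᴸ : ∀ (l : List (Fin v)) c f → c * ∑ᴸ l f ≡ ∑ᴸ l (λ x → c * f x)
*-distribˡ-∑ᴸ []      c f = *-zeroʳ c
*-distribˡ-∑ᴸ (x ∷ l) c f = trans (*-distribˡ-+ c (f x) _) (cong (_+_ (c * f x)) (*-distribˡ-∑ᴸ l c f))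

module OrderedTriple {a b c : Fin v} (a<b : a <ᶠ b) (b<c : b <ᶠ c) where

  abc : List (Fin v)
  abc = a ∷ b ∷ c ∷ []

  private
    a<c : a <ᶠ c
    a<c = Fin.<-trans a<b b<c

    weigh : ∀ x (h : Fin v → ℤ) {α β γ} → ⟦ x <ᵇ a ⟧ ≡ α → ⟦ x <ᵇ b ⟧ ≡ β → ⟦ x <ᵇ c ⟧ ≡ γ →
            ∑ᴸ abc (λ y → ⟦ x <ᵇ y ⟧ * h y) ≡ α * h a + (β * h b + (γ * h c + 0ℤ))
    weigh x h α≡ β≡ γ≡ = cong₂ _+_ (cong (_* h a) α≡) (cong₂ _+_ (cong (_* h b) β≡) (cong₂ _+_ (cong (_* h c) γ≡) refl))

  above-a : ∀ (h : Fin v → ℤ) → ∑ᴸ abc (λ y → ⟦ a <ᵇ y ⟧ * h y) ≡ h b + h c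
  above-a h = trans (weigh a h (⟦<ᵇ⟧-no (Fin.<-irrefl refl)) (⟦<ᵇ⟧-yes a<b) (⟦<ᵇ⟧-yes a<c)) (simplify (h a) (h b) (h c))
    where
    simplify : ∀ p q r → 0ℤ * p + (1ℤ * q + (1ℤ * r + 0ℤ)) ≡ q + r
    simplify = solve-∀

  above-b : ∀ (h : Fin v → ℤ) → ∑ᴸ abc (λ y → ⟦ b <ᵇ y ⟧ * h y) ≡ h c
  above-b h = trans (weigh b h (⟦<ᵇ⟧-no (Fin.<-asym a<b)) (⟦<ᵇ⟧-no (Fin.<-irrefl refl)) (⟦<ᵇ⟧-yes b<c))
                    (simplify (h a) (h b) (h c))
    where
    simplify : ∀ p q r → 0ℤ * p + (0ℤ * q + (1ℤ * r + 0ℤ)) ≡ r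
    simplify = solve-∀

  above-c : ∀ (h : Fin v → ℤ) → ∑ᴸ abc (λ y → ⟦ c <ᵇ y ⟧ * h y) ≡ 0ℤ
  above-c h = weigh c h (⟦<ᵇ⟧-no (Fin.<-asym a<c)) (⟦<ᵇ⟧-no (Fin.<-asym b<c)) (⟦<ᵇ⟧-no (Fin.<-irrefl refl))

  ∑-increasing-pairs : ∀ (g : Fin v → Fin v → ℤ) →
    ∑ᴸ abc (λ x → ∑ᴸ abc (λ y → ⟦ x <ᵇ y ⟧ * g x y)) ≡ g a b + g a c + g b c
  ∑-increasing-pairs g =
    trans (cong₂ _+_ (above-a (g a)) (cong₂ _+_ (above-b (g b)) (cong₂ _+_ (above-c (g c)) refl)))
          (simplify (g a b) (g a c) (g b c))
    where
    simplify : ∀ p q r → p + q + (r + (0ℤ + 0ℤ)) ≡ p + q + r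
    simplify = solve-∀

  ∑-increasing-triples : ∀ (g : Fin v → Fin v → Fin v → ℤ) →
    ∑ᴸ abc (λ x → ∑ᴸ abc (λ y → ∑ᴸ abc (λ z → ⟦ x <ᵇ y ⟧ * (⟦ y <ᵇ z ⟧ * g x y z)))) ≡ g a b c
  ∑-increasing-triples g = begin
    ∑ᴸ abc (λ x → ∑ᴸ abc (λ y → ∑ᴸ abc (λ z → ⟦ x <ᵇ y ⟧ * (⟦ y <ᵇ z ⟧ * g x y z))))
      ≡⟨ ∑ᴸ-cong abc (λ x → ∑ᴸ-cong abc λ y → sym (*-distribˡ-∑ᴸ abc ⟦ x <ᵇ y ⟧ (λ z → ⟦ y <ᵇ z ⟧ * g x y z))) ⟩
    ∑ᴸ abc (λ x → ∑ᴸ abc (λ y → ⟦ x <ᵇ y ⟧ * ∑ᴸ abc (λ z → ⟦ y <ᵇ z ⟧ * g x y z)))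
      ≡⟨ ∑-increasing-pairs (λ x y → ∑ᴸ abc (λ z → ⟦ y <ᵇ z ⟧ * g x y z)) ⟩
    ∑ᴸ abc (λ z → ⟦ b <ᵇ z ⟧ * g a b z) + ∑ᴸ abc (λ z → ⟦ c <ᵇ z ⟧ * g a c z) + ∑ᴸ abc (λ z → ⟦ c <ᵇ z ⟧ * g b c z)
      ≡⟨ cong₂ _+_ (cong₂ _+_ (above-b (g a b)) (above-c (g a c))) (above-c (g b c)) ⟩
    g a b c + 0ℤ + 0ℤ
      ≡⟨ trans (+-identityʳ _) (+-identityʳ _) ⟩
    g a b c ∎
    where open ≡-Reasoning

module _ {A : Set} {P : Pred A 0ℓ} (P? : Decidable P) where

  length-filter-concatMap : ∀ {B : Set} {n} (f : B → List A) (g : Fin n → B) →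
    + length (filter P? (concatMap f (tabulate g))) ≡ ∑[ i < n ] (+ length (filter P? (f (g i))))
  length-filter-concatMap {n = zero}  f g = refl
  length-filter-concatMap {n = suc n} f g = begin
    + length (filter P? (f (g zero) ++ rest))
      ≡⟨ cong (λ xs → + length xs) (filter-++ P? (f (g zero)) rest) ⟩
    + length (filter P? (f (g zero)) ++ filter P? rest)
      ≡⟨ cong +_ (length-++ (filter P? (f (g zero)))) ⟩
    + (length (filter P? (f (g zero))) ℕ.+ length (filter P? rest))
      ≡⟨ pos-+ (length (filter P? (f (g zero)))) _ ⟩
    + length (filter P? (f (g zero))) + + length (filter P? rest)
      ≡⟨ cong (_+_ (+ length (filter P? (f (g zero))))) (length-filter-concatMap f (λ i → g (suc i))) ⟩
    ∑[ i < suc n ] (+ length (filter P? (f (g i)))) ∎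
    where
    open ≡-Reasoning
    rest : List A
    rest = concatMap f (tabulate (λ i → g (suc i)))

  length-filter-if : ∀ b (x : A) → + length (filter P? (if b then [ x ] else [])) ≡ ⟦ b ∧ does (P? x) ⟧
  length-filter-if false x = refl
  length-filter-if true  x with does (P? x)
  ... | true  = refl
  ... | false = refl

edgeTerm : Graph v → Vec (Fin v) 2 → ℤ
edgeTerm G (x ∷ y ∷ []) = ⟦ x <ᵇ y ⟧ * ⟦ adj G x y ⟧

homTerm : Graph v → Vec (Fin v) 3 → ℤ
homTerm G (x ∷ y ∷ z ∷ []) = ⟦ x <ᵇ y ⟧ * (⟦ y <ᵇ z ⟧ * ⟦ homogeneous G (x , y , z) ⟧)

⌊∈?⌋≡∈ᵇ : ∀ (x : Fin v) K → ⌊ x ∈? K ⌋ ≡ x ∈ᵇ K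
⌊∈?⌋≡∈ᵇ zero    (true ∷ K)  = refl
⌊∈?⌋≡∈ᵇ zero    (false ∷ K) = refl
⌊∈?⌋≡∈ᵇ (suc x) (b ∷ K)     = trans (⌊⌋-map′ _ _ (x ∈? K)) (⌊∈?⌋≡∈ᵇ x K)

does-≟true : ∀ b → does (b ≟ᵇ true) ≡ b
does-≟true true  = refl
does-≟true false = refl

e↾≡localSum : ∀ (G : Graph v) K → + e↾ G K ≡ localSum (edgeTerm G) K
e↾≡localSum {v} G K = begin
  + e↾ G K
    ≡⟨ length-filter-concatMap P? (λ x → concatMap (pair x) (allFin v)) (λ x → x) ⟩
  ∑[ x < v ] (+ length (filter P? (concatMap (pair x) (allFin v))))
    ≡⟨ sum-cong-≗ (λ x → length-filter-concatMap P? (pair x) (λ y → y)) ⟩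
  ∑[ x < v ] ∑[ y < v ] (+ length (filter P? (pair x y)))
    ≡⟨ sum-cong-≗ (λ x → sum-cong-≗ λ y → term x y) ⟩
  localSum (edgeTerm G) K ∎
  where
  open ≡-Reasoning
  P? : (p : Fin v × Fin v) → Dec (adj G (proj₁ p) (proj₂ p) ≡ true)
  P? (x , y) = adj G x y ≟ᵇ true
  pair : Fin v → Fin v → List (Fin v × Fin v)
  pair x y = if ⌊ x ∈? K ⌋ ∧ ⌊ y ∈? K ⌋ ∧ ⌊ x <ᶠ? y ⌋ then [ (x , y) ] else []
  conjuncts : ∀ x y → (⌊ x ∈? K ⌋ ∧ ⌊ y ∈? K ⌋ ∧ x <ᵇ y) ∧ does (adj G x y ≟ᵇ true)
                      ≡ setOf (x ∷ y ∷ []) ⊆ᵇ K ∧ x <ᵇ y ∧ adj G x y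
  conjuncts x y rewrite ⌊∈?⌋≡∈ᵇ x K | ⌊∈?⌋≡∈ᵇ y K | does-≟true (adj G x y)
                      | setOf⊆ᵇ-∷ x (y ∷ []) K | setOf⊆ᵇ-∷ y [] K | ⊥⊆ᵇ K
                      with x ∈ᵇ K | y ∈ᵇ K
  ... | true  | true  = refl
  ... | true  | false = refl
  ... | false | _     = refl
  term : ∀ x y → + length (filter P? (pair x y)) ≡ ⟦ setOf (x ∷ y ∷ []) ⊆ᵇ K ⟧ * edgeTerm G (x ∷ y ∷ [])
  term x y = begin
    + length (filter P? (pair x y))
      ≡⟨ length-filter-if P? (⌊ x ∈? K ⌋ ∧ ⌊ y ∈? K ⌋ ∧ x <ᵇ y) (x , y) ⟩
    ⟦ (⌊ x ∈? K ⌋ ∧ ⌊ y ∈? K ⌋ ∧ x <ᵇ y) ∧ does (adj G x y ≟ᵇ true) ⟧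
      ≡⟨ cong ⟦_⟧ (conjuncts x y) ⟩
    ⟦ setOf (x ∷ y ∷ []) ⊆ᵇ K ∧ x <ᵇ y ∧ adj G x y ⟧
      ≡⟨ ⟦∧⟧ (setOf (x ∷ y ∷ []) ⊆ᵇ K) _ ⟩
    ⟦ setOf (x ∷ y ∷ []) ⊆ᵇ K ⟧ * ⟦ x <ᵇ y ∧ adj G x y ⟧
      ≡⟨ cong (⟦ setOf (x ∷ y ∷ []) ⊆ᵇ K ⟧ *_) (⟦∧⟧ (x <ᵇ y) (adj G x y)) ⟩
    ⟦ setOf (x ∷ y ∷ []) ⊆ᵇ K ⟧ * edgeTerm G (x ∷ y ∷ []) ∎

h3↾≡localSum : ∀ (G : Graph v) K → + h3↾ G K ≡ localSum (homTerm G) K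
h3↾≡localSum {v} G K = begin
  + h3↾ G K
    ≡⟨ length-filter-concatMap P? (λ x → concatMap (λ y → concatMap (triple x y) (allFin v)) (allFin v)) (λ x → x) ⟩
  ∑[ x < v ] (+ length (filter P? (concatMap (λ y → concatMap (triple x y) (allFin v)) (allFin v))))
    ≡⟨ sum-cong-≗ (λ x → length-filter-concatMap P? (λ y → concatMap (triple x y) (allFin v)) (λ y → y)) ⟩
  ∑[ x < v ] ∑[ y < v ] (+ length (filter P? (concatMap (triple x y) (allFin v))))
    ≡⟨ sum-cong-≗ (λ x → sum-cong-≗ λ y → length-filter-concatMap P? (triple x y) (λ z → z)) ⟩
  ∑[ x < v ] ∑[ y < v ] ∑[ z < v ] (+ length (filter P? (triple x y z)))
    ≡⟨ sum-cong-≗ (λ x → sum-cong-≗ λ y → sum-cong-≗ λ z → term x y z) ⟩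
  localSum (homTerm G) K ∎
  where
  open ≡-Reasoning
  P? : (t : Fin v × Fin v × Fin v) → Dec (homogeneous G t ≡ true)
  P? t = homogeneous G t ≟ᵇ true
  triple : Fin v → Fin v → Fin v → List (Fin v × Fin v × Fin v)
  triple x y z = if ⌊ x ∈? K ⌋ ∧ ⌊ y ∈? K ⌋ ∧ ⌊ z ∈? K ⌋ ∧ ⌊ x <ᶠ? y ⌋ ∧ ⌊ y <ᶠ? z ⌋
                 then [ (x , y , z) ] else []
  conjuncts : ∀ x y z →
    (⌊ x ∈? K ⌋ ∧ ⌊ y ∈? K ⌋ ∧ ⌊ z ∈? K ⌋ ∧ x <ᵇ y ∧ y <ᵇ z) ∧ does (homogeneous G (x , y , z) ≟ᵇ true)
      ≡ setOf (x ∷ y ∷ z ∷ []) ⊆ᵇ K ∧ x <ᵇ y ∧ y <ᵇ z ∧ homogeneous G (x , y , z)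
  conjuncts x y z rewrite ⌊∈?⌋≡∈ᵇ x K | ⌊∈?⌋≡∈ᵇ y K | ⌊∈?⌋≡∈ᵇ z K | does-≟true (homogeneous G (x , y , z))
                        | setOf⊆ᵇ-∷ x (y ∷ z ∷ []) K | setOf⊆ᵇ-∷ y (z ∷ []) K | setOf⊆ᵇ-∷ z [] K | ⊥⊆ᵇ K
                        with x ∈ᵇ K | y ∈ᵇ K | z ∈ᵇ K
  ... | true  | true  | true  = ∧-assoc (x <ᵇ y) (y <ᵇ z) _
  ... | true  | true  | false = refl
  ... | true  | false | _     = refl
  ... | false | _     | _     = refl
  term : ∀ x y z → + length (filter P? (triple x y z)) ≡ ⟦ setOf (x ∷ y ∷ z ∷ []) ⊆ᵇ K ⟧ * homTerm G (x ∷ y ∷ z ∷ [])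
  term x y z = begin
    + length (filter P? (triple x y z))
      ≡⟨ length-filter-if P? (⌊ x ∈? K ⌋ ∧ ⌊ y ∈? K ⌋ ∧ ⌊ z ∈? K ⌋ ∧ x <ᵇ y ∧ y <ᵇ z) (x , y , z) ⟩
    ⟦ (⌊ x ∈? K ⌋ ∧ ⌊ y ∈? K ⌋ ∧ ⌊ z ∈? K ⌋ ∧ x <ᵇ y ∧ y <ᵇ z) ∧ does (homogeneous G (x , y , z) ≟ᵇ true) ⟧
      ≡⟨ cong ⟦_⟧ (conjuncts x y z) ⟩
    ⟦ setOf (x ∷ y ∷ z ∷ []) ⊆ᵇ K ∧ x <ᵇ y ∧ y <ᵇ z ∧ homogeneous G (x , y , z) ⟧
      ≡⟨ ⟦∧⟧ (setOf (x ∷ y ∷ z ∷ []) ⊆ᵇ K) _ ⟩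
    ⟦ setOf (x ∷ y ∷ z ∷ []) ⊆ᵇ K ⟧ * ⟦ x <ᵇ y ∧ y <ᵇ z ∧ homogeneous G (x , y , z) ⟧
      ≡⟨ cong (⟦ setOf (x ∷ y ∷ z ∷ []) ⊆ᵇ K ⟧ *_)
              (trans (⟦∧⟧ (x <ᵇ y) _) (cong (⟦ x <ᵇ y ⟧ *_) (⟦∧⟧ (y <ᵇ z) _))) ⟩
    ⟦ setOf (x ∷ y ∷ z ∷ []) ⊆ᵇ K ⟧ * homTerm G (x ∷ y ∷ z ∷ []) ∎

-- The defects

+n*x≡0⇒x≡0 : ∀ n x → 0 < n → + n * x ≡ 0ℤ → x ≡ 0ℤ
+n*x≡0⇒x≡0 (suc n) x _ n*x≡0 with ℤ.i*j≡0⇒i≡0∨j≡0 (+ suc n) n*x≡0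
... | inj₂ x≡0 = x≡0

pascal-cancel : ∀ a b x y → + (a ℕ.+ b) * x + + b * y ≡ 0ℤ → x + y ≡ 0ℤ → + a * x ≡ 0ℤ
pascal-cancel a b x y sum≡0 x+y≡0 = begin
  + a * x                                      ≡⟨ regroup (+ a) (+ b) x y ⟩
  (+ a + + b) * x + + b * y - + b * (x + y)    ≡⟨ cong₂ (λ s t → s * x + + b * y - + b * t) (pos-+ a b) (sym x+y≡0) ⟨
  + (a ℕ.+ b) * x + + b * y - + b * 0ℤ         ≡⟨ cong₂ (λ s t → s - t) sum≡0 (*-zeroʳ (+ b)) ⟩
  0ℤ                                           ∎
  where
  open ≡-Reasoning
  regroup : ∀ a b x y → a * x ≡ (a + b) * x + b * y - b * (x + y)
  regroup = solve-∀

all-Bool? : {P : Bool → Set} → (∀ b → Dec (P b)) → Dec (∀ b → P b)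
all-Bool? P? with P? false | P? true
... | yes f | yes t = yes λ { false → f ; true → t }
... | no ¬f | _     = no λ all → ¬f (all false)
... | yes _ | no ¬t = no λ all → ¬t (all true)

triangle-identity : ∀ p q r p′ q′ r′ →
  (⟦ p′ ⟧ + ⟦ q′ ⟧ + ⟦ r′ ⟧ - (⟦ p ⟧ + ⟦ q ⟧ + ⟦ r ⟧))
    * (⟦ p′ ⟧ + ⟦ q′ ⟧ + ⟦ r′ ⟧ - (⟦ not p ⟧ + ⟦ not q ⟧ + ⟦ not r ⟧))
    ≡ + 2 * (⟦ (p′ ∧ r′ ∧ q′) ∨ (not p′ ∧ not r′ ∧ not q′) ⟧ - ⟦ (p ∧ r ∧ q) ∨ (not p ∧ not r ∧ not q) ⟧)
-- Decided by evaluation on all 64 assignments.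
triangle-identity = toWitness {a? = all-Bool? λ p → all-Bool? λ q → all-Bool? λ r →
                                    all-Bool? λ p′ → all-Bool? λ q′ → all-Bool? λ r′ → _ ℤ.≟ _} _

edgeDefect : Graph v → Graph v → Subset v → ℤ
edgeDefect G G' S = (+ e↾ G' S - + e↾ G S) * (+ e↾ G' S - + e↾ (complement G) S)

h3Defect : Graph v → Graph v → Subset v → ℤ
h3Defect G G' S = + h3↾ G' S - + h3↾ G S

adj-complement : ∀ (G : Graph v) {x y} → x ≢ y → adj (complement G) x y ≡ not (adj G x y)
adj-complement G {x} {y} x≢y with x Fin.≟ y
... | yes x≡y = ⊥-elim (x≢y x≡y)
... | no _    = refl

module _ {a b c : Fin v} {S : Subset v} (a<b : a <ᶠ b) (b<c : b <ᶠ c) (S≡abc : elements S ≡ a ∷ b ∷ c ∷ []) where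
  open OrderedTriple a<b b<c

  e↾-triangle : ∀ (H : Graph v) → + e↾ H S ≡ ⟦ adj H a b ⟧ + ⟦ adj H a c ⟧ + ⟦ adj H b c ⟧
  e↾-triangle H = begin
    + e↾ H S                            ≡⟨ e↾≡localSum H S ⟩
    localSum (edgeTerm H) S             ≡⟨ localSum-elements 2 (edgeTerm H) S ⟩
    ∑ᴸᵗ (elements S) 2 (edgeTerm H)     ≡⟨ cong (λ l → ∑ᴸᵗ l 2 (edgeTerm H)) S≡abc ⟩
    ∑ᴸᵗ abc 2 (edgeTerm H)              ≡⟨ ∑-increasing-pairs (λ x y → ⟦ adj H x y ⟧) ⟩
    ⟦ adj H a b ⟧ + ⟦ adj H a c ⟧ + ⟦ adj H b c ⟧ ∎
    where open ≡-Reasoning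

  h3↾-triangle : ∀ (H : Graph v) → + h3↾ H S ≡ ⟦ homogeneous H (a , b , c) ⟧
  h3↾-triangle H = begin
    + h3↾ H S                           ≡⟨ h3↾≡localSum H S ⟩
    localSum (homTerm H) S              ≡⟨ localSum-elements 3 (homTerm H) S ⟩
    ∑ᴸᵗ (elements S) 3 (homTerm H)      ≡⟨ cong (λ l → ∑ᴸᵗ l 3 (homTerm H)) S≡abc ⟩
    ∑ᴸᵗ abc 3 (homTerm H)               ≡⟨ ∑-increasing-triples (λ x y z → ⟦ homogeneous H (x , y , z) ⟧) ⟩
    ⟦ homogeneous H (a , b , c) ⟧ ∎
    where open ≡-Reasoning

  e↾-complement-triangle : ∀ (H : Graph v) →
    + e↾ (complement H) S ≡ ⟦ not (adj H a b) ⟧ + ⟦ not (adj H a c) ⟧ + ⟦ not (adj H b c) ⟧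
  e↾-complement-triangle H =
    trans (e↾-triangle (complement H))
          (cong₃ (λ p q r → ⟦ p ⟧ + ⟦ q ⟧ + ⟦ r ⟧) (adj-complement H (Fin.<⇒≢ a<b))
                 (adj-complement H (Fin.<⇒≢ (Fin.<-trans a<b b<c))) (adj-complement H (Fin.<⇒≢ b<c)))
    where
    cong₃ : ∀ {A : Set} (f : Bool → Bool → Bool → A) {p p′ q q′ r r′} → p ≡ p′ → q ≡ q′ → r ≡ r′ → f p q r ≡ f p′ q′ r′
    cong₃ f refl refl refl = refl

edgeDefect-triangle : ∀ {v} (G G' : Graph v) S → ∣ S ∣ ≡ 3 → edgeDefect G G' S ≡ + 2 * h3Defect G G' S
edgeDefect-triangle {v} G G' S ∣S∣≡3 with three-elements S ∣S∣≡3
... | a , b , c , a<b , b<c , S≡abc = begin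
  (+ e↾ G' S - + e↾ G S) * (+ e↾ G' S - + e↾ (complement G) S)
    ≡⟨ cong₂ (λ e′ e → (e′ - e) * (e′ - + e↾ (complement G) S))
             (e↾-triangle a<b b<c S≡abc G') (e↾-triangle a<b b<c S≡abc G) ⟩
  (E G' - E G) * (E G' - + e↾ (complement G) S)
    ≡⟨ cong (λ ē → (E G' - E G) * (E G' - ē)) (e↾-complement-triangle a<b b<c S≡abc G) ⟩
  (E G' - E G) * (E G' - (⟦ not (adj G a b) ⟧ + ⟦ not (adj G a c) ⟧ + ⟦ not (adj G b c) ⟧))
    ≡⟨ triangle-identity (adj G a b) (adj G a c) (adj G b c) (adj G' a b) (adj G' a c) (adj G' b c) ⟩
  + 2 * (⟦ homogeneous G' (a , b , c) ⟧ - ⟦ homogeneous G (a , b , c) ⟧)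
    ≡⟨ cong₂ (λ h′ h → + 2 * (h′ - h)) (h3↾-triangle a<b b<c S≡abc G') (h3↾-triangle a<b b<c S≡abc G) ⟨
  + 2 * (+ h3↾ G' S - + h3↾ G S) ∎
  where
  open ≡-Reasoning
  E : Graph v → ℤ
  E H = ⟦ adj H a b ⟧ + ⟦ adj H a c ⟧ + ⟦ adj H b c ⟧

module _ {v} (G G' : Graph v) where

  edgeChange : Graph v → Vec (Fin v) 2 → ℤ
  edgeChange H xs = edgeTerm G' xs - edgeTerm H xs

  edgeDefectTerm : Vec (Fin v) 4 → ℤ
  edgeDefectTerm = edgeChange G ⊗ edgeChange (complement G)

  h3Change : Vec (Fin v) 3 → ℤ
  h3Change xs = homTerm G' xs - homTerm G xs

  edgeDefect≡localSum : ∀ S → edgeDefect G G' S ≡ localSum edgeDefectTerm S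
  edgeDefect≡localSum S = begin
    (+ e↾ G' S - + e↾ G S) * (+ e↾ G' S - + e↾ Ḡ S)
      ≡⟨ cong₂ _*_ (cong₂ _-_ (e↾≡localSum G' S) (e↾≡localSum G S))
                   (cong₂ _-_ (e↾≡localSum G' S) (e↾≡localSum Ḡ S)) ⟩
    (localSum (edgeTerm G') S - localSum (edgeTerm G) S) * (localSum (edgeTerm G') S - localSum (edgeTerm Ḡ) S)
      ≡⟨ cong₂ _*_ (localSum-- (edgeTerm G') (edgeTerm G) S) (localSum-- (edgeTerm G') (edgeTerm Ḡ) S) ⟨
    localSum (edgeChange G) S * localSum (edgeChange Ḡ) S
      ≡⟨ localSum-* (edgeChange G) (edgeChange Ḡ) S ⟩
    localSum edgeDefectTerm S ∎
    where
    open ≡-Reasoning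
    Ḡ : Graph v
    Ḡ = complement G

  edgeChange-exclusive : ∀ {x y} → x <ᶠ y →
    edgeChange G (x ∷ y ∷ []) * edgeChange (complement G) (x ∷ y ∷ []) ≡ 0ℤ
  edgeChange-exclusive {x} {y} x<y with x <ᶠ? y | x Fin.≟ y
  ... | no x≮y | _       = ⊥-elim (x≮y x<y)
  ... | yes _  | yes x≡y = ⊥-elim (Fin.<⇒≢ x<y x≡y)
  ... | yes _  | no _ with adj G x y | adj G' x y
  ...   | true  | true  = refl
  ...   | true  | false = refl
  ...   | false | true  = refl
  ...   | false | false = refl

  edgeChange-≮ : ∀ H {x y} → ¬ x <ᶠ y → edgeChange H (x ∷ y ∷ []) ≡ 0ℤ
  edgeChange-≮ H {x} {y} x≮y with x <ᶠ? y
  ... | yes x<y = ⊥-elim (x≮y x<y)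
  ... | no _    = refl

  edgeDefectTerm-support : ∀ xs → edgeDefectTerm xs ≡ 0ℤ ⊎ (∣ setOf xs ∣ ≡ 3 ⊎ ∣ setOf xs ∣ ≡ 4)
  edgeDefectTerm-support (x ∷ y ∷ z ∷ w ∷ []) = support (x <ᶠ? y) (z <ᶠ? w)
    where
    dxy szw : ℤ
    dxy = edgeChange G (x ∷ y ∷ [])
    szw = edgeChange (complement G) (z ∷ w ∷ [])
    support : Dec (x <ᶠ y) → Dec (z <ᶠ w) →
              dxy * szw ≡ 0ℤ ⊎ (∣ setOf (x ∷ y ∷ z ∷ w ∷ []) ∣ ≡ 3 ⊎ ∣ setOf (x ∷ y ∷ z ∷ w ∷ []) ∣ ≡ 4)
    support (no x≮y) _         = inj₁ (cong (_* szw) (edgeChange-≮ G x≮y))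
    support _         (no z≮w) = inj₁ (trans (cong (dxy *_) (edgeChange-≮ (complement G) z≮w)) (*-zeroʳ dxy))
    support (yes x<y) (yes z<w) with ∣setOf-two-pairs∣ x<y z<w
    ... | inj₁ (refl , refl) = inj₁ (edgeChange-exclusive x<y)
    ... | inj₂ sizes         = inj₂ sizes

  h3Change-support : ∀ xs → h3Change xs ≡ 0ℤ ⊎ ∣ setOf xs ∣ ≡ 3
  h3Change-support (x ∷ y ∷ z ∷ []) with x <ᶠ? y | y <ᶠ? z
  ... | no _    | _       = inj₁ refl
  ... | yes _   | no _    = inj₁ refl
  ... | yes x<y | yes y<z = inj₂ (∣setOf-increasing-triple∣ x<y y<z)

  edgeDefect₃ edgeDefect₄ : Subset v → ℤ
  edgeDefect₃ = localSum (restrict 3 edgeDefectTerm)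
  edgeDefect₄ = localSum (restrict 4 edgeDefectTerm)

  edgeDefect-split : ∀ S → edgeDefect G G' S ≡ edgeDefect₃ S + edgeDefect₄ S
  edgeDefect-split S = begin
    edgeDefect G G' S
      ≡⟨ edgeDefect≡localSum S ⟩
    localSum edgeDefectTerm S
      ≡⟨ localSum-cong (λ xs → restrict-split 3 4 edgeDefectTerm xs (λ ()) (edgeDefectTerm-support xs)) S ⟩
    localSum (λ xs → restrict 3 edgeDefectTerm xs + restrict 4 edgeDefectTerm xs) S
      ≡⟨ localSum-+ (restrict 3 edgeDefectTerm) (restrict 4 edgeDefectTerm) S ⟩
    edgeDefect₃ S + edgeDefect₄ S ∎
    where open ≡-Reasoning

  h3Defect≡localSum : ∀ S → h3Defect G G' S ≡ localSum (restrict 3 h3Change) S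
  h3Defect≡localSum S = begin
    + h3↾ G' S - + h3↾ G S
      ≡⟨ cong₂ _-_ (h3↾≡localSum G' S) (h3↾≡localSum G S) ⟩
    localSum (homTerm G') S - localSum (homTerm G) S
      ≡⟨ localSum-- (homTerm G') (homTerm G) S ⟨
    localSum h3Change S
      ≡⟨ localSum-cong (λ xs → restrict-exact 3 h3Change xs (h3Change-support xs)) S ⟩
    localSum (restrict 3 h3Change) S ∎
    where open ≡-Reasoning

  module _ (K : Subset v) (n : ℕ) (∣K∣≡4+n : ∣ K ∣ ≡ 4 ℕ.+ n) where

    ∑⊆-edgeDefect : ∀ m →
      ∑⊆ K m (edgeDefect G G') ≡ + supersets (suc n) 3 m * edgeDefect₃ K + + supersets n 4 m * edgeDefect₄ K
    ∑⊆-edgeDefect m = begin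
      ∑⊆ K m (edgeDefect G G')
        ≡⟨ ∑⊆-cong K m (λ S _ → edgeDefect-split S) ⟩
      ∑⊆ K m (λ S → edgeDefect₃ S + edgeDefect₄ S)
        ≡⟨ ∑⊆-distrib-+ K m edgeDefect₃ edgeDefect₄ ⟩
      ∑⊆ K m edgeDefect₃ + ∑⊆ K m edgeDefect₄
        ≡⟨ cong₂ _+_ (∑⊆-localSum edgeDefectTerm K 3 (suc n) m ∣K∣≡4+n) (∑⊆-localSum edgeDefectTerm K 4 n m ∣K∣≡4+n) ⟩
      + supersets (suc n) 3 m * edgeDefect₃ K + + supersets n 4 m * edgeDefect₄ K ∎
      where open ≡-Reasoning

    ∑⊆-h3Defect : ∀ m → ∑⊆ K m (h3Defect G G') ≡ + supersets (suc n) 3 m * h3Defect G G' K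
    ∑⊆-h3Defect m = begin
      ∑⊆ K m (h3Defect G G')
        ≡⟨ ∑⊆-cong K m (λ S _ → h3Defect≡localSum S) ⟩
      ∑⊆ K m (localSum (restrict 3 h3Change))
        ≡⟨ ∑⊆-localSum h3Change K 3 (suc n) m ∣K∣≡4+n ⟩
      + supersets (suc n) 3 m * localSum (restrict 3 h3Change) K
        ≡⟨ cong (+ supersets (suc n) 3 m *_) (h3Defect≡localSum K) ⟨
      + supersets (suc n) 3 m * h3Defect G G' K ∎
      where open ≡-Reasoning

    edgeDefect₃≡2*h3Defect : edgeDefect₃ K ≡ + 2 * h3Defect G G' K
    edgeDefect₃≡2*h3Defect = begin
      edgeDefect₃ K
        ≡⟨ trans (+-identityʳ (1ℤ * edgeDefect₃ K)) (*-identityˡ (edgeDefect₃ K)) ⟨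
      1ℤ * edgeDefect₃ K + 0ℤ * edgeDefect₄ K
        ≡⟨ cong₂ (λ s t → + s * edgeDefect₃ K + + t * edgeDefect₄ K)
                 (supersets-diagonal (suc n) 3) (supersets-below n (ℕ.n<1+n 3)) ⟨
      + supersets (suc n) 3 3 * edgeDefect₃ K + + supersets n 4 3 * edgeDefect₄ K
        ≡⟨ ∑⊆-edgeDefect 3 ⟨
      ∑⊆ K 3 (edgeDefect G G')
        ≡⟨ ∑⊆-cong K 3 (λ S ∣S∣≡3 → edgeDefect-triangle G G' S ∣S∣≡3) ⟩
      ∑⊆ K 3 (λ S → + 2 * h3Defect G G' S)
        ≡⟨ *-distribˡ-∑⊆ K 3 (+ 2) (h3Defect G G') ⟨
      + 2 * ∑⊆ K 3 (h3Defect G G')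
        ≡⟨ cong (+ 2 *_) (∑⊆-h3Defect 3) ⟩
      + 2 * (+ supersets (suc n) 3 3 * h3Defect G G' K)
        ≡⟨ cong (λ s → + 2 * (+ s * h3Defect G G' K)) (supersets-diagonal (suc n) 3) ⟩
      + 2 * (1ℤ * h3Defect G G' K)
        ≡⟨ cong (+ 2 *_) (*-identityˡ (h3Defect G G' K)) ⟩
      + 2 * h3Defect G G' K ∎
      where open ≡-Reasoning

  EdgeCond⇒edgeDefect≡0 : ∀ S → EdgeCond G G' S → edgeDefect G G' S ≡ 0ℤ
  EdgeCond⇒edgeDefect≡0 S (inj₁ e≡) =
    cong (_* (+ e↾ G' S - + e↾ (complement G) S)) (ℤ.i≡j⇒i-j≡0 (cong +_ e≡))
  EdgeCond⇒edgeDefect≡0 S (inj₂ e≡) =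
    trans (cong ((+ e↾ G' S - + e↾ G S) *_) (ℤ.i≡j⇒i-j≡0 (cong +_ e≡))) (*-zeroʳ (+ e↾ G' S - + e↾ G S))

  edgeDefect≡0⇒EdgeCond : ∀ S → edgeDefect G G' S ≡ 0ℤ → EdgeCond G G' S
  edgeDefect≡0⇒EdgeCond S Q≡0 with ℤ.i*j≡0⇒i≡0∨j≡0 (+ e↾ G' S - + e↾ G S) Q≡0
  ... | inj₁ d≡0 = inj₁ (ℤ.+-injective (ℤ.i-j≡0⇒i≡j _ _ d≡0))
  ... | inj₂ d≡0 = inj₂ (ℤ.+-injective (ℤ.i-j≡0⇒i≡j _ _ d≡0))

  h3↾≡⇒h3Defect≡0 : ∀ S → h3↾ G S ≡ h3↾ G' S → h3Defect G G' S ≡ 0ℤ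
  h3↾≡⇒h3Defect≡0 S h≡ = ℤ.i≡j⇒i-j≡0 (cong +_ (sym h≡))

  h3Defect≡0⇒h3↾≡ : ∀ S → h3Defect G G' S ≡ 0ℤ → h3↾ G S ≡ h3↾ G' S
  h3Defect≡0⇒h3↾≡ S D≡0 = sym (ℤ.+-injective (ℤ.i-j≡0⇒i≡j _ _ D≡0))

  h3↾-agree-from-edges : ∀ {K k′} → 3 ≤ k′ → k′ < ∣ K ∣ →
    (∀ S → ∣ S ∣ ≡ k′ → EdgeCond G G' S) → EdgeCond G G' K → h3↾ G K ≡ h3↾ G' K
  h3↾-agree-from-edges {K} {k′} 3≤k′ k′<∣K∣ edges-k′ edges-K
    with n , 4+n≡∣K∣ ← ℕ.m≤n⇒∃[o]m+o≡n (ℕ.≤-trans (s≤s 3≤k′) k′<∣K∣) =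
    h3Defect≡0⇒h3↾≡ K (+n*x≡0⇒x≡0 2 (h3Defect G G' K) ℕ.z<s 2*D≡0)
    where
    ∣K∣≡4+n : ∣ K ∣ ≡ 4 ℕ.+ n
    ∣K∣≡4+n = sym 4+n≡∣K∣
    e₃+e₄≡0 : edgeDefect₃ K + edgeDefect₄ K ≡ 0ℤ
    e₃+e₄≡0 = trans (sym (edgeDefect-split K)) (EdgeCond⇒edgeDefect≡0 K edges-K)
    -- supersets (suc n) 3 k′ unfolds to supersets n 3 k′ + supersets n 4 k′.
    s*e₃≡0 : + supersets n 3 k′ * edgeDefect₃ K ≡ 0ℤ
    s*e₃≡0 = pascal-cancel (supersets n 3 k′) (supersets n 4 k′) _ _
      (trans (sym (∑⊆-edgeDefect K n ∣K∣≡4+n k′))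
             (∑⊆-vanishing K k′ λ S ∣S∣≡k′ → EdgeCond⇒edgeDefect≡0 S (edges-k′ S ∣S∣≡k′)))
      e₃+e₄≡0
    e₃≡0 : edgeDefect₃ K ≡ 0ℤ
    e₃≡0 = +n*x≡0⇒x≡0 (supersets n 3 k′) (edgeDefect₃ K)
             (supersets-positive n 3≤k′ (ℕ.≤-pred (subst (k′ <_) ∣K∣≡4+n k′<∣K∣))) s*e₃≡0
    2*D≡0 : + 2 * h3Defect G G' K ≡ 0ℤ
    2*D≡0 = trans (sym (edgeDefect₃≡2*h3Defect K n ∣K∣≡4+n)) e₃≡0

  conditions-upward : ∀ {L k} → 4 ≤ k → k ≤ ∣ L ∣ →
    (∀ S → ∣ S ∣ ≡ k → EdgeCond G G' S × h3↾ G S ≡ h3↾ G' S) → EdgeCond G G' L × h3↾ G L ≡ h3↾ G' L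
  conditions-upward {L} {k} 4≤k k≤∣L∣ conditions-k
    with n , 4+n≡∣L∣ ← ℕ.m≤n⇒∃[o]m+o≡n (ℕ.≤-trans 4≤k k≤∣L∣) =
    edgeDefect≡0⇒EdgeCond L Q≡0 , h3Defect≡0⇒h3↾≡ L D≡0
    where
    open ≡-Reasoning
    ∣L∣≡4+n : ∣ L ∣ ≡ 4 ℕ.+ n
    ∣L∣≡4+n = sym 4+n≡∣L∣
    k≤4+n : k ≤ 4 ℕ.+ n
    k≤4+n = subst (k ≤_) ∣L∣≡4+n k≤∣L∣
    D≡0 : h3Defect G G' L ≡ 0ℤ
    D≡0 = +n*x≡0⇒x≡0 (supersets (suc n) 3 k) (h3Defect G G' L)
            (supersets-positive (suc n) (ℕ.≤-trans (ℕ.n≤1+n 3) 4≤k) k≤4+n)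
            (trans (sym (∑⊆-h3Defect L n ∣L∣≡4+n k))
                   (∑⊆-vanishing L k λ S ∣S∣≡k → h3↾≡⇒h3Defect≡0 S (proj₂ (conditions-k S ∣S∣≡k))))
    e₃≡0 : edgeDefect₃ L ≡ 0ℤ
    e₃≡0 = trans (edgeDefect₃≡2*h3Defect L n ∣L∣≡4+n) (cong (+ 2 *_) D≡0)
    e₄≡0 : edgeDefect₄ L ≡ 0ℤ
    e₄≡0 = +n*x≡0⇒x≡0 (supersets n 4 k) (edgeDefect₄ L) (supersets-positive n 4≤k k≤4+n) (begin
      + supersets n 4 k * edgeDefect₄ L
        ≡⟨ +-identityˡ _ ⟨
      0ℤ + + supersets n 4 k * edgeDefect₄ L
        ≡⟨ cong (_+ + supersets n 4 k * edgeDefect₄ L)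
                (trans (cong (+ supersets (suc n) 3 k *_) e₃≡0) (*-zeroʳ (+ supersets (suc n) 3 k))) ⟨
      + supersets (suc n) 3 k * edgeDefect₃ L + + supersets n 4 k * edgeDefect₄ L
        ≡⟨ ∑⊆-edgeDefect L n ∣L∣≡4+n k ⟨
      ∑⊆ L k (edgeDefect G G')
        ≡⟨ ∑⊆-vanishing L k (λ S ∣S∣≡k → EdgeCond⇒edgeDefect≡0 S (proj₁ (conditions-k S ∣S∣≡k))) ⟩
      0ℤ ∎)
    Q≡0 : edgeDefect G G' L ≡ 0ℤ
    Q≡0 = trans (edgeDefect-split L) (cong₂ _+_ e₃≡0 e₄≡0)

corollary3p5 : (v k : ℕ) → 4 ≤ k → k ≤ v → (G G' : Graph v) →
    -- (ii) ⇒ (i)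
    ((∃[ k' ] (3 ≤ k' × k' < k ×
        ((K : Subset v) → (∣ K ∣ ≡ k ⊎ ∣ K ∣ ≡ k') → EdgeCond G G' K)))
      → ((K : Subset v) → ∣ K ∣ ≡ k → EdgeCond G G' K × h3↾ G K ≡ h3↾ G' K))
    ×
    -- (i) ⇒ (iii)
    (((K : Subset v) → ∣ K ∣ ≡ k → EdgeCond G G' K × h3↾ G K ≡ h3↾ G' K)
      → ((l : ℕ) → k ≤ l → l ≤ v → (L : Subset v) → ∣ L ∣ ≡ l →
           EdgeCond G G' L × h3↾ G L ≡ h3↾ G' L))
corollary3p5 v k 4≤k _ G G' =
  (λ (k′ , 3≤k′ , k′<k , edges) K ∣K∣≡k →
     edges K (inj₁ ∣K∣≡k) ,
     h3↾-agree-from-edges G G' 3≤k′ (subst (k′ <_) (sym ∣K∣≡k) k′<k)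
       (λ S ∣S∣≡k′ → edges S (inj₂ ∣S∣≡k′)) (edges K (inj₁ ∣K∣≡k))) ,
  (λ conditions l k≤l _ L ∣L∣≡l → conditions-upward G G' 4≤k (subst (k ≤_) (sym ∣L∣≡l) k≤l) conditions)
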